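{- Let $M$ be a matroid on a finite set $E$ with $r(M)>0$. If $M$ is a unique expansion matroid, then $M$ is a union minimal matroid.
   Context: $\mathcal{B}(M)$ is the family of bases, $r(M)$ the common cardinality of bases. $s(M)=\{A \text{ independent}: |A|=r(M)-1\}$. $M$ is a unique expansion matroid if for every $B\in\mathcal{B}(M)$ and every $A\in s(M)$, whenever $e_1,e_2\in B$ satisfy $A\cup\{e_1\},A\cup\{e_2\}\in\mathcal{B}(M)$, then $e_1=e_2$. $M$ is union minimal if for every matroid $M_1$ on $E$ with $\bigcup\mathcal{B}(M_1)=\bigcup\mathcal{B}(M)$ and $\mathcal{B}(M_1)\subseteq\mathcal{B}(M)$ we have $\mathcal{B}(M_1)=\mathcal{B}(M)$. -}

module Defs where

open import Data.Nat using (ℕ; _∸_)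
open import Data.Fin using (Fin)
open import Data.Fin.Subset using (Subset; _∈_; _∉_; _⊆_; _∪_; _-_; ⁅_⁆; ∣_∣)
open import Data.Product using (Σ; ∃; _×_; _,_)
open import Relation.Binary.PropositionalEquality using (_≡_)

record Matroid (n : ℕ) : Set₁ where
  field
    IsBase    : Subset n → Set
    base-nonempty : ∃ λ B → IsBase B
    exchange  : ∀ B₁ B₂ → IsBase B₁ → IsBase B₂ →
                ∀ x → x ∈ B₁ → x ∉ B₂ →
                ∃ λ y → y ∈ B₂ × y ∉ B₁ × IsBase ((B₁ - x) ∪ ⁅ y ⁆)
open Matroid public

module _ {n : ℕ} (M : Matroid n) where

  Independent : Subset n → Set
  Independent A = ∃ λ B → IsBase M B × A ⊆ B

  HasRank : ℕ → Set
  HasRank r = ∀ B → IsBase M B → ∣ B ∣ ≡ r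

  InS : ℕ → Subset n → Set
  InS r A = Independent A × ∣ A ∣ ≡ r ∸ 1

  UniqueExpansion : ℕ → Set
  UniqueExpansion r =
    ∀ B → IsBase M B → ∀ A → InS r A →
    ∀ e₁ e₂ → e₁ ∈ B → e₂ ∈ B →
    IsBase M (A ∪ ⁅ e₁ ⁆) → IsBase M (A ∪ ⁅ e₂ ⁆) → e₁ ≡ e₂

  InUnionOfBases : Fin n → Set
  InUnionOfBases e = ∃ λ B → IsBase M B × e ∈ B

UnionMinimal : ∀ {n} → Matroid n → Set₁
UnionMinimal {n} M =
  ∀ (M₁ : Matroid n) →
  (∀ e → (InUnionOfBases M₁ e → InUnionOfBases M e) × (InUnionOfBases M e → InUnionOfBases M₁ e)) →
  (∀ B → IsBase M₁ B → IsBase M B) →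
  ∀ B → IsBase M B → IsBase M₁ B

-- Given a base B of M, walk from any base of M₁ towards B: if z ∈ B₁ ∖ B,
-- basis exchange in M gives w ∈ B with A ∪ {w} ∈ 𝓑(M), where A = B₁ - z ∈ s(M).
-- Since w lies in a base B₂ of M₁, unique expansion on B₂ forces z ∉ B₂, and
-- the M₁-exchange of z into B₂ must produce exactly w; so A ∪ {w} ∈ 𝓑(M₁).
-- This strictly shrinks B₁ ∖ B, and at the end B₁ ⊆ B with |B₁| = |B| gives B ∈ 𝓑(M₁).
module Submission where

open import Defs
open import Data.Nat using (ℕ; _<_; suc; _∸_)
open import Data.Nat.Properties using (<-irrefl; ≤-<-trans)
open import Data.Nat.Induction using (<-wellFounded)
open import Data.Bool using (true; false)
open import Data.Fin using (Fin; zero; suc; _≟_)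
open import Data.Fin.Properties using (any?)
open import Data.Fin.Subset
open import Data.Fin.Subset.Properties
  using (_∈?_; ⊆-antisym; p─⊥≡p; p─q⊆p; p⊆q⇒∣p∣≤∣q∣; p⊂q⇒∣p∣<∣q∣; x∈p⇒∣p-x∣<∣p∣;
         x∈p∧x∉q⇒x∈p─q; x∈p∧x≢y⇒x∈p-y; x∈p∪q⁺; x∈p∪q⁻; x∈⁅x⁆; x∈⁅y⁆⇒x≡y; x∉⁅y⁆⇒x≢y)
open import Data.Vec.Base using (_∷_; here; there)
open import Data.Product using (∃; _×_; _,_; proj₁; proj₂)
open import Data.Sum using (_⊎_; inj₁; inj₂)
open import Function using (_∘_)
open import Induction.WellFounded using (Acc; acc)
open import Relation.Nullary using (Dec; yes; no; ¬?; contradiction)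
open import Relation.Nullary.Decidable using (_×-dec_; decidable-stable)
open import Relation.Binary.PropositionalEquality using (_≡_; _≢_; refl; sym; trans; cong; subst)

private variable n : ℕ

⊆-or-∃∈∉ : (p q : Subset n) → p ⊆ q ⊎ ∃ λ x → x ∈ p × x ∉ q
⊆-or-∃∈∉ p q with any? (λ x → x ∈? p ×-dec ¬? (x ∈? q))
... | yes witness = inj₂ witness
... | no ∄ = inj₁ λ {x} x∈p → decidable-stable (x ∈? q) (λ x∉q → ∄ (x , x∈p , x∉q))

p⊆q∧∣p∣≡∣q∣⇒p≡q : {p q : Subset n} → p ⊆ q → ∣ p ∣ ≡ ∣ q ∣ → p ≡ q
p⊆q∧∣p∣≡∣q∣⇒p≡q {p = p} {q = q} p⊆q ∣p∣≡∣q∣ with ⊆-or-∃∈∉ q p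
... | inj₁ q⊆p = ⊆-antisym p⊆q q⊆p
... | inj₂ x∈q∖p = contradiction (subst (_< ∣ q ∣) ∣p∣≡∣q∣ (p⊂q⇒∣p∣<∣q∣ (p⊆q , x∈q∖p))) (<-irrefl refl)

x∈p─q⁻ : {x : Fin n} (p q : Subset n) → x ∈ p ─ q → x ∈ p × x ∉ q
x∈p─q⁻ (true ∷ p) (false ∷ q) here = here , λ ()
x∈p─q⁻ {x = zero} (true ∷ p) (true ∷ q) ()
x∈p─q⁻ {x = zero} (false ∷ p) (true ∷ q) ()
x∈p─q⁻ {x = zero} (false ∷ p) (false ∷ q) ()
x∈p─q⁻ (_ ∷ p) (_ ∷ q) (there x∈p─q) with x∈p─q⁻ p q x∈p─q
... | x∈p , x∉q = there x∈p , λ { (there x∈q) → x∉q x∈q }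

x∈p-y⁻ : {x : Fin n} (p : Subset n) (y : Fin n) → x ∈ p - y → x ∈ p × x ≢ y
x∈p-y⁻ p y x∈p-y with x∈p─q⁻ p ⁅ y ⁆ x∈p-y
... | x∈p , x∉⁅y⁆ = x∈p , x∉⁅y⁆⇒x≢y x∉⁅y⁆

p-x∪⁅x⁆≡p : {x : Fin n} (p : Subset n) → x ∈ p → (p - x) ∪ ⁅ x ⁆ ≡ p
p-x∪⁅x⁆≡p {x = x} p x∈p = ⊆-antisym ⊆p p⊆
  where
  ⊆p : (p - x) ∪ ⁅ x ⁆ ⊆ p
  ⊆p {y} y∈ with x∈p∪q⁻ (p - x) ⁅ x ⁆ y∈
  ... | inj₁ y∈p-x = proj₁ (x∈p-y⁻ p x y∈p-x)
  ... | inj₂ y∈⁅x⁆ = subst (_∈ p) (sym (x∈⁅y⁆⇒x≡y x y∈⁅x⁆)) x∈p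
  p⊆ : p ⊆ (p - x) ∪ ⁅ x ⁆
  p⊆ {y} y∈p with y ≟ x
  ... | yes refl = x∈p∪q⁺ (inj₂ (x∈⁅x⁆ x))
  ... | no y≢x = x∈p∪q⁺ (inj₁ (x∈p∧x≢y⇒x∈p-y y∈p y≢x))

∣p-x∣+1≡∣p∣ : {x : Fin n} (p : Subset n) → x ∈ p → suc ∣ p - x ∣ ≡ ∣ p ∣
∣p-x∣+1≡∣p∣ (true ∷ p) here = cong (suc ∘ ∣_∣) (p─⊥≡p p)
∣p-x∣+1≡∣p∣ (true ∷ p) (there x∈p) = cong suc (∣p-x∣+1≡∣p∣ p x∈p)
∣p-x∣+1≡∣p∣ (false ∷ p) (there x∈p) = ∣p-x∣+1≡∣p∣ p x∈p

∣p-z∪⁅w⁆─q∣<∣p─q∣ : {z w : Fin n} (p q : Subset n) → z ∈ p → z ∉ q → w ∈ q →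
                    ∣ ((p - z) ∪ ⁅ w ⁆) ─ q ∣ < ∣ p ─ q ∣
∣p-z∪⁅w⁆─q∣<∣p─q∣ {z = z} {w} p q z∈p z∉q w∈q =
  ≤-<-trans (p⊆q⇒∣p∣≤∣q∣ ⊆p─q-z) (x∈p⇒∣p-x∣<∣p∣ (x∈p∧x∉q⇒x∈p─q z∈p z∉q))
  where
  ⊆p─q-z : ((p - z) ∪ ⁅ w ⁆) ─ q ⊆ (p ─ q) - z
  ⊆p─q-z x∈ with x∈p─q⁻ ((p - z) ∪ ⁅ w ⁆) q x∈
  ... | x∈p-z∪⁅w⁆ , x∉q with x∈p∪q⁻ (p - z) ⁅ w ⁆ x∈p-z∪⁅w⁆
  ...   | inj₁ x∈p-z = let x∈p , x≢z = x∈p-y⁻ p z x∈p-z in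
                       x∈p∧x≢y⇒x∈p-y (x∈p∧x∉q⇒x∈p─q x∈p x∉q) x≢z
  ...   | inj₂ x∈⁅w⁆ = contradiction (subst (_∈ q) (sym (x∈⁅y⁆⇒x≡y w x∈⁅w⁆)) w∈q) x∉q

module _ (P : Subset n → Set) (q : Subset n)
         (exchange-into : ∀ {p z} → P p → z ∈ p → z ∉ q → ∃ λ w → w ∈ q × P ((p - z) ∪ ⁅ w ⁆))
         where

  exchange-walk : ∀ {p} → P p → ∃ λ p′ → P p′ × p′ ⊆ q
  exchange-walk {p} = walk (<-wellFounded ∣ p ─ q ∣)
    where
    walk : ∀ {p} → Acc _<_ ∣ p ─ q ∣ → P p → ∃ λ p′ → P p′ × p′ ⊆ q
    walk {p} (acc smaller) Pp with ⊆-or-∃∈∉ p q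
    ... | inj₁ p⊆q = p , Pp , p⊆q
    ... | inj₂ (z , z∈p , z∉q) with exchange-into Pp z∈p z∉q
    ...   | w , w∈q , Pp′ = walk (smaller (∣p-z∪⁅w⁆─q∣<∣p─q∣ p q z∈p z∉q w∈q)) Pp′

base-minus-InS : {M : Matroid n} {r : ℕ} → HasRank M r →
                 ∀ {B z} → IsBase M B → z ∈ B → InS M r (B - z)
base-minus-InS rank {B} {z} B∈𝓑 z∈B =
  (B , B∈𝓑 , p─q⊆p B ⁅ z ⁆) , cong (_∸ 1) (trans (∣p-x∣+1≡∣p∣ B z∈B) (rank B B∈𝓑))

module _ {M M₁ : Matroid n} {r : ℕ} (rank : HasRank M r) (unique : UniqueExpansion M r)
         (𝓑₁⊆𝓑 : ∀ B → IsBase M₁ B → IsBase M B) where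

  expansion-in-submatroid : ∀ {B₁ B₂ z w} → IsBase M₁ B₁ → IsBase M₁ B₂ →
                            z ∈ B₁ → w ∉ B₁ → w ∈ B₂ →
                            IsBase M ((B₁ - z) ∪ ⁅ w ⁆) → IsBase M₁ ((B₁ - z) ∪ ⁅ w ⁆)
  expansion-in-submatroid {B₁} {B₂} {z} {w} B₁∈𝓑₁ B₂∈𝓑₁ z∈B₁ w∉B₁ w∈B₂ A∪w∈𝓑 = decide (z ∈? B₂)
    where
    expands-only-by-w : ∀ {e} → e ∈ B₂ → IsBase M ((B₁ - z) ∪ ⁅ e ⁆) → e ≡ w
    expands-only-by-w e∈B₂ A∪e∈𝓑 =
      unique B₂ (𝓑₁⊆𝓑 B₂ B₂∈𝓑₁) (B₁ - z) (base-minus-InS {M = M} rank (𝓑₁⊆𝓑 B₁ B₁∈𝓑₁) z∈B₁)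
             _ w e∈B₂ w∈B₂ A∪e∈𝓑 A∪w∈𝓑

    A∪z∈𝓑 : IsBase M ((B₁ - z) ∪ ⁅ z ⁆)
    A∪z∈𝓑 = subst (IsBase M) (sym (p-x∪⁅x⁆≡p B₁ z∈B₁)) (𝓑₁⊆𝓑 B₁ B₁∈𝓑₁)

    decide : Dec (z ∈ B₂) → IsBase M₁ ((B₁ - z) ∪ ⁅ w ⁆)
    decide (yes z∈B₂) = contradiction (subst (_∈ B₁) (expands-only-by-w z∈B₂ A∪z∈𝓑) z∈B₁) w∉B₁
    decide (no z∉B₂) with exchange M₁ B₁ B₂ B₁∈𝓑₁ B₂∈𝓑₁ z z∈B₁ z∉B₂
    ... | y , y∈B₂ , _ , A∪y∈𝓑₁ =
      subst (λ e → IsBase M₁ ((B₁ - z) ∪ ⁅ e ⁆)) (expands-only-by-w y∈B₂ (𝓑₁⊆𝓑 _ A∪y∈𝓑₁)) A∪y∈𝓑₁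

  exchange-into-base : (∀ e → InUnionOfBases M e → InUnionOfBases M₁ e) →
                       ∀ {B B₁ z} → IsBase M B → IsBase M₁ B₁ → z ∈ B₁ → z ∉ B →
                       ∃ λ w → w ∈ B × IsBase M₁ ((B₁ - z) ∪ ⁅ w ⁆)
  exchange-into-base ⋃𝓑⊆⋃𝓑₁ {B} {B₁} {z} B∈𝓑 B₁∈𝓑₁ z∈B₁ z∉B
    with exchange M B₁ B (𝓑₁⊆𝓑 B₁ B₁∈𝓑₁) B∈𝓑 z z∈B₁ z∉B
  ... | w , w∈B , w∉B₁ , A∪w∈𝓑 with ⋃𝓑⊆⋃𝓑₁ w (B , B∈𝓑 , w∈B)
  ...   | B₂ , B₂∈𝓑₁ , w∈B₂ =
    w , w∈B , expansion-in-submatroid B₁∈𝓑₁ B₂∈𝓑₁ z∈B₁ w∉B₁ w∈B₂ A∪w∈𝓑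

theorem10 : ∀ {n : ℕ} (M : Matroid n) (r : ℕ) → HasRank M r → 0 < r →
              UniqueExpansion M r → UnionMinimal M
theorem10 M r rank _ unique M₁ same-⋃𝓑 𝓑₁⊆𝓑 B B∈𝓑
  with exchange-walk (IsBase M₁) B
         (exchange-into-base {M = M} {M₁} rank unique 𝓑₁⊆𝓑 (λ e → proj₂ (same-⋃𝓑 e)) B∈𝓑)
         (proj₂ (base-nonempty M₁))
... | B′ , B′∈𝓑₁ , B′⊆B =
  subst (IsBase M₁) (p⊆q∧∣p∣≡∣q∣⇒p≡q B′⊆B (trans (rank B′ (𝓑₁⊆𝓑 B′ B′∈𝓑₁)) (sym (rank B B∈𝓑)))) B′∈𝓑₁
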